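{- Let $a$ and $m$ be positive integers and $f_0(n)=\binom{a}{n-1}$ for $n=1,2,\ldots$. Then for $1\le k\le n$, \[c_m(n,k)=\sum_{i=k}^n(m-1)^{i-k}\binom{i-1}{k-1}\binom{ia}{n-i},\qquad f_m(n)=\sum_{i=1}^n m^{i-1}\binom{ia}{n-i}.\]
   Context: For an arithmetic function $f_0$ defined on the positive integers, define recursively for $m\ge 1$: $c_m(n,k)=\sum_{i_1+\cdots+i_k=n} f_{m-1}(i_1)\cdots f_{m-1}(i_k)$, the sum over all $k$-tuples of positive integers with sum $n$, and $f_m(n)=\sum_{k=1}^n c_m(n,k)$. The convention $0^0=1$ is used. -}

module Defs where

open import Data.Nat using (ℕ; zero; suc; _+_; _*_; _∸_; _^_)
open import Data.Nat.Combinatorics using (_C_)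
open import Data.List using (List; []; _∷_; map; concatMap; applyUpTo)
open import Data.Nat.ListAction using (sum)
open import Data.Vec using (Vec; []; _∷_)
import Data.Vec as Vec

range : ℕ → ℕ → List ℕ
range lo hi = applyUpTo (λ j → lo + j) (suc hi ∸ lo)

Σ[_to_] : ℕ → ℕ → (ℕ → ℕ) → ℕ
Σ[ lo to hi ] g = sum (map g (range lo hi))

-- All k-tuples (i₁,…,i_k) of positive integers with i₁ + ⋯ + i_k = n
compositions : (n k : ℕ) → List (Vec ℕ k)
compositions zero    zero    = [] ∷ []
compositions (suc n) zero    = []
compositions n       (suc k) =
  concatMap (λ i → map (i ∷_) (compositions (n ∸ i) k)) (range 1 n)

prodVec : {k : ℕ} → (ℕ → ℕ) → Vec ℕ k → ℕ
prodVec g []       = 1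
prodVec g (x ∷ xs) = g x * prodVec g xs

compSum : (ℕ → ℕ) → ℕ → ℕ → ℕ
compSum f n k = sum (map (prodVec f) (compositions n k))

fSeq : (ℕ → ℕ) → ℕ → ℕ → ℕ
cSeq : (ℕ → ℕ) → ℕ → ℕ → ℕ → ℕ
fSeq f₀ zero    n = f₀ n
fSeq f₀ (suc m) n = Σ[ 1 to n ] (λ k → cSeq f₀ (suc m) n k)
cSeq f₀ zero    n k = 0   -- c_0 is not defined in the paper; never used
cSeq f₀ (suc m) n k = compSum (fSeq f₀ m) n k

-- f₀(n) = binom(a, n-1) for n ≥ 1 (value at 0 irrelevant)
binomSeq : ℕ → ℕ → ℕ
binomSeq a n = a C (n ∸ 1)

-- With y = x(1+x)^a the generating function of f₀ is y, and a composition
-- sum of k parts is the k-th power of a generating function.  Hence, by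
-- induction on m, F_m = y / (1 - m y): indeed F_m = F_{m-1} / (1 - F_{m-1})
-- and y/(1-(m-1)y) / (1 - y/(1-(m-1)y)) = y/(1-my).  The coefficient c_m(n,k)
-- is [xⁿ] (y / (1-(m-1)y))^k, and [xⁿ] yⁱ = binom(ia, n-i) by Vandermonde.
-- Power series are coefficient functions ℕ → ℕ, and substituting y into a
-- series u is the finite sum Σ_{i ≤ n} u_i [xⁿ] yⁱ, which is multiplicative.
module Submission where

open import Defs
open import Data.Nat using (ℕ; zero; suc; _+_; _*_; _∸_; _^_; _≤_; _<_; z≤n; s≤s)
open import Data.Nat.Properties
open import Data.Nat.Combinatorics using (_C_; k>n⇒nCk≡0; nCk+nC[k+1]≡[n+1]C[k+1])
open import Data.Nat.ListAction using (sum)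
open import Data.Nat.ListAction.Properties using (sum-++)
open import Data.List using (List; []; _∷_; _++_; map; concatMap; applyUpTo)
open import Data.List.Properties using (map-++)
open import Data.Vec using (Vec; _∷_)
open import Data.Product using (_×_; _,_)
open import Function using (_∘_)
open import Relation.Nullary using (yes; no)
open import Relation.Binary.PropositionalEquality
open ≡-Reasoning
open import Algebra.Properties.CommutativeSemigroup +-commutativeSemigroup
  using () renaming (interchange to +-interchange)
open import Algebra.Properties.CommutativeSemigroup *-commutativeSemigroup
  using () renaming (interchange to *-interchange)

∑< : ℕ → (ℕ → ℕ) → ℕ
∑< zero    g = 0
∑< (suc n) g = g 0 + ∑< n (g ∘ suc)

syntax ∑< n (λ i → e) = ∑[ i < n ] e

∑<-cong-< : ∀ n {g h : ℕ → ℕ} → (∀ i → i < n → g i ≡ h i) → ∑< n g ≡ ∑< n h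
∑<-cong-< zero    eq = refl
∑<-cong-< (suc n) eq = cong₂ _+_ (eq 0 (s≤s z≤n)) (∑<-cong-< n (λ i i<n → eq (suc i) (s≤s i<n)))

∑<-cong : ∀ n {g h : ℕ → ℕ} → g ≗ h → ∑< n g ≡ ∑< n h
∑<-cong n eq = ∑<-cong-< n (λ i _ → eq i)

∑<-≡0 : ∀ n {g : ℕ → ℕ} → (∀ i → i < n → g i ≡ 0) → ∑< n g ≡ 0
∑<-≡0 zero    eq = refl
∑<-≡0 (suc n) eq = cong₂ _+_ (eq 0 (s≤s z≤n)) (∑<-≡0 n (λ i i<n → eq (suc i) (s≤s i<n)))

∑<-distrib-+ : ∀ n g h → ∑[ i < n ] (g i + h i) ≡ ∑< n g + ∑< n h
∑<-distrib-+ zero    g h = refl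
∑<-distrib-+ (suc n) g h = begin
  g 0 + h 0 + ∑[ i < n ] (g (suc i) + h (suc i))  ≡⟨ cong (g 0 + h 0 +_) (∑<-distrib-+ n (g ∘ suc) (h ∘ suc)) ⟩
  g 0 + h 0 + (∑< n (g ∘ suc) + ∑< n (h ∘ suc))    ≡⟨ +-interchange (g 0) (h 0) _ _ ⟩
  ∑< (suc n) g + ∑< (suc n) h                      ∎

∑<-distribˡ-* : ∀ n c g → ∑[ i < n ] (c * g i) ≡ c * ∑< n g
∑<-distribˡ-* zero    c g = sym (*-zeroʳ c)
∑<-distribˡ-* (suc n) c g =
  trans (cong (c * g 0 +_) (∑<-distribˡ-* n c (g ∘ suc))) (sym (*-distribˡ-+ c (g 0) _))

∑<-distribʳ-* : ∀ n c g → ∑[ i < n ] (g i * c) ≡ ∑< n g * c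
∑<-distribʳ-* n c g =
  trans (∑<-cong n (λ i → *-comm (g i) c)) (trans (∑<-distribˡ-* n c g) (*-comm c _))

∑<-suc : ∀ n g → ∑< (suc n) g ≡ ∑< n g + g n
∑<-suc zero    g = +-comm (g 0) 0
∑<-suc (suc n) g = trans (cong (g 0 +_) (∑<-suc n (g ∘ suc))) (sym (+-assoc (g 0) _ _))

∑<-+ : ∀ k j g → ∑< (k + j) g ≡ ∑< k g + ∑[ t < j ] g (k + t)
∑<-+ zero    j g = refl
∑<-+ (suc k) j g = trans (cong (g 0 +_) (∑<-+ k j (g ∘ suc))) (sym (+-assoc (g 0) _ _))

∑<-comm : ∀ n m (h : ℕ → ℕ → ℕ) → ∑[ i < n ] ∑[ j < m ] h i j ≡ ∑[ j < m ] ∑[ i < n ] h i j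
∑<-comm zero    m h = sym (∑<-≡0 m (λ _ _ → refl))
∑<-comm (suc n) m h = begin
  ∑< m (h 0) + ∑[ i < n ] ∑[ j < m ] h (suc i) j  ≡⟨ cong (∑< m (h 0) +_) (∑<-comm n m (h ∘ suc)) ⟩
  ∑< m (h 0) + ∑[ j < m ] ∑[ i < n ] h (suc i) j  ≡⟨ ∑<-distrib-+ m (h 0) _ ⟨
  ∑[ j < m ] ∑[ i < suc n ] h i j                 ∎

∑<-extend : ∀ {n N} → n ≤ N → (g : ℕ → ℕ) → (∀ i → n ≤ i → g i ≡ 0) → ∑< n g ≡ ∑< N g
∑<-extend {n} {N} n≤N g vanish = begin
  ∑< n g                                 ≡⟨ +-identityʳ _ ⟨
  ∑< n g + 0                             ≡⟨ cong (∑< n g +_) (∑<-≡0 (N ∸ n) (λ t _ → vanish (n + t) (m≤m+n n t))) ⟨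
  ∑< n g + ∑[ t < N ∸ n ] g (n + t)      ≡⟨ ∑<-+ n (N ∸ n) g ⟨
  ∑< (n + (N ∸ n)) g                     ≡⟨ cong (λ l → ∑< l g) (m+[n∸m]≡n n≤N) ⟩
  ∑< N g                                 ∎

∑<-triangle : ∀ n (h : ℕ → ℕ → ℕ) →
  ∑[ l < suc n ] ∑[ s < suc l ] h s (l ∸ s) ≡ ∑[ s < suc n ] ∑[ t < suc (n ∸ s) ] h s t
∑<-triangle zero    h = refl
∑<-triangle (suc n) h =
  trans (∑<-distrib-+ (suc (suc n)) (h 0) (λ l → ∑[ s < l ] h (suc s) (l ∸ suc s)))
        (cong (∑< (suc (suc n)) (h 0) +_) (∑<-triangle n (h ∘ suc)))

∑<-*-∑< : ∀ n f g → ∑< n f * ∑< n g ≡ ∑[ i < n ] ∑[ j < n ] (f i * g j)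
∑<-*-∑< n f g =
  trans (sym (∑<-distribʳ-* n (∑< n g) f)) (∑<-cong n (λ i → sym (∑<-distribˡ-* n (f i) g)))

Series : Set
Series = ℕ → ℕ

shift : Series → Series
shift u zero    = 0
shift u (suc n) = u n

shift^ : ℕ → Series → Series
shift^ zero    u = u
shift^ (suc i) u = shift (shift^ i u)

one : Series
one zero    = 1
one (suc n) = 0

_⊕_ : Series → Series → Series
(u ⊕ v) n = u n + v n

_⊛_ : Series → Series → Series
(u ⊛ v) n = ∑[ p < suc n ] (u p * v (n ∸ p))

infixl 6 _⊕_
infixl 7 _⊛_

shift-cong : ∀ {u v} → u ≗ v → shift u ≗ shift v
shift-cong eq zero    = refl
shift-cong eq (suc n) = eq n

shift^-cong : ∀ i {u v} → u ≗ v → shift^ i u ≗ shift^ i v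
shift^-cong zero    eq = eq
shift^-cong (suc i) eq = shift-cong (shift^-cong i eq)

shift^-+ : ∀ i j u → shift^ (i + j) u ≗ shift^ i (shift^ j u)
shift^-+ zero    j u n = refl
shift^-+ (suc i) j u   = shift-cong (shift^-+ i j u)

shift^-< : ∀ i u n → n < i → shift^ i u n ≡ 0
shift^-< (suc i) u zero    _         = refl
shift^-< (suc i) u (suc n) (s≤s n<i) = shift^-< i u n n<i

shift^-≥ : ∀ i u n → i ≤ n → shift^ i u n ≡ u (n ∸ i)
shift^-≥ zero    u n       _         = refl
shift^-≥ (suc i) u (suc n) (s≤s i≤n) = shift^-≥ i u n i≤n

⊛-congˡ : ∀ {u u′} v → u ≗ u′ → u ⊛ v ≗ u′ ⊛ v
⊛-congˡ v eq n = ∑<-cong (suc n) (λ p → cong (_* v (n ∸ p)) (eq p))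

⊛-identityˡ : ∀ v → one ⊛ v ≗ v
⊛-identityˡ v n = trans (cong (1 * v n +_) (∑<-≡0 n (λ _ _ → refl)))
                        (trans (+-identityʳ _) (*-identityˡ _))

⊛-distribʳ-⊕ : ∀ u w v → (u ⊕ w) ⊛ v ≗ u ⊛ v ⊕ w ⊛ v
⊛-distribʳ-⊕ u w v n =
  trans (∑<-cong (suc n) (λ p → *-distribʳ-+ (v (n ∸ p)) (u p) (w p)))
        (∑<-distrib-+ (suc n) (λ p → u p * v (n ∸ p)) (λ p → w p * v (n ∸ p)))

shift-⊛ : ∀ u v → shift u ⊛ v ≗ shift (u ⊛ v)
shift-⊛ u v zero    = refl
shift-⊛ u v (suc n) = refl

⊛-shift : ∀ u v → u ⊛ shift v ≗ shift (u ⊛ v)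
⊛-shift u v zero    = trans (+-identityʳ _) (*-zeroʳ (u 0))
⊛-shift u v (suc n) = begin
  ∑[ p < suc (suc n) ] (u p * shift v (suc n ∸ p))            ≡⟨ ∑<-suc (suc n) (λ p → u p * shift v (suc n ∸ p)) ⟩
  ∑[ p < suc n ] (u p * shift v (suc n ∸ p)) + u (suc n) * shift v (n ∸ n)
    ≡⟨ cong₂ _+_ (∑<-cong-< (suc n) below) (cong (λ l → u (suc n) * shift v l) (n∸n≡0 n)) ⟩
  ∑[ p < suc n ] (u p * v (n ∸ p)) + u (suc n) * 0            ≡⟨ cong ((u ⊛ v) n +_) (*-zeroʳ (u (suc n))) ⟩
  ∑[ p < suc n ] (u p * v (n ∸ p)) + 0                        ≡⟨ +-identityʳ _ ⟩
  (u ⊛ v) n                                                   ∎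
  where
  below : ∀ p → p < suc n → u p * shift v (suc n ∸ p) ≡ u p * v (n ∸ p)
  below p (s≤s p≤n) = cong (λ l → u p * shift v l) (+-∸-assoc 1 p≤n)

u₀≡0⇒⊛-tail : ∀ u v → u 0 ≡ 0 → ∀ n → (u ⊛ v) n ≡ ∑[ j < n ] (u (suc j) * v (n ∸ suc j))
u₀≡0⇒⊛-tail u v u₀≡0 n = cong (λ c → c * v n + ∑[ j < n ] (u (suc j) * v (n ∸ suc j))) u₀≡0

shift^-⊛ : ∀ i u v → shift^ i u ⊛ v ≗ shift^ i (u ⊛ v)
shift^-⊛ zero    u v n = refl
shift^-⊛ (suc i) u v n = trans (shift-⊛ (shift^ i u) v n) (shift-cong (shift^-⊛ i u v) n)

⊛-shift^ : ∀ i u v → u ⊛ shift^ i v ≗ shift^ i (u ⊛ v)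
⊛-shift^ zero    u v n = refl
⊛-shift^ (suc i) u v n = trans (⊛-shift u (shift^ i v) n) (shift-cong (⊛-shift^ i u v) n)

binomial : ℕ → Series
binomial s k = s C k

binomial-zero : binomial 0 ≗ one
binomial-zero zero    = refl
binomial-zero (suc k) = refl

binomial-suc : ∀ s → binomial (suc s) ≗ binomial s ⊕ shift (binomial s)
binomial-suc s zero    = refl
binomial-suc s (suc k) = trans (sym (nCk+nC[k+1]≡[n+1]C[k+1] s k)) (+-comm (s C k) _)

vandermonde : ∀ s t → binomial s ⊛ binomial t ≗ binomial (s + t)
vandermonde zero    t n = trans (⊛-congˡ (binomial t) binomial-zero n) (⊛-identityˡ (binomial t) n)
vandermonde (suc s) t n = begin
  (binomial (suc s) ⊛ binomial t) n                                    ≡⟨ ⊛-congˡ (binomial t) (binomial-suc s) n ⟩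
  ((binomial s ⊕ shift (binomial s)) ⊛ binomial t) n                   ≡⟨ ⊛-distribʳ-⊕ (binomial s) (shift (binomial s)) (binomial t) n ⟩
  (binomial s ⊛ binomial t) n + (shift (binomial s) ⊛ binomial t) n    ≡⟨ cong₂ _+_ (vandermonde s t n) (shift-⊛ (binomial s) (binomial t) n) ⟩
  binomial (s + t) n + shift (binomial s ⊛ binomial t) n               ≡⟨ cong (binomial (s + t) n +_) (shift-cong (vandermonde s t) n) ⟩
  binomial (s + t) n + shift (binomial (s + t)) n                      ≡⟨ binomial-suc (s + t) n ⟨
  binomial (suc s + t) n                                               ∎

-- the coefficients of yⁱ, where y = x(1+x)^a
yPow : ℕ → ℕ → Series
yPow a i = shift^ i (binomial (i * a))

yPow-⊛ : ∀ a i j → yPow a i ⊛ yPow a j ≗ yPow a (i + j)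
yPow-⊛ a i j n = begin
  (shift^ i (binomial (i * a)) ⊛ shift^ j (binomial (j * a))) n    ≡⟨ shift^-⊛ i (binomial (i * a)) (shift^ j (binomial (j * a))) n ⟩
  shift^ i (binomial (i * a) ⊛ shift^ j (binomial (j * a))) n      ≡⟨ shift^-cong i (⊛-shift^ j (binomial (i * a)) (binomial (j * a))) n ⟩
  shift^ i (shift^ j (binomial (i * a) ⊛ binomial (j * a))) n      ≡⟨ shift^-cong i (shift^-cong j (vandermonde (i * a) (j * a))) n ⟩
  shift^ i (shift^ j (binomial (i * a + j * a))) n                 ≡⟨ shift^-+ i j (binomial (i * a + j * a)) n ⟨
  shift^ (i + j) (binomial (i * a + j * a)) n                      ≡⟨ cong (λ s → shift^ (i + j) (binomial s) n) (*-distribʳ-+ a i j) ⟨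
  yPow a (i + j) n                                                 ∎

yPow-< : ∀ a i n → n < i → yPow a i n ≡ 0
yPow-< a i = shift^-< i (binomial (i * a))

yPow-≥ : ∀ a i n → i ≤ n → yPow a i n ≡ (i * a) C (n ∸ i)
yPow-≥ a i = shift^-≥ i (binomial (i * a))

-- the coefficients of u(y) = Σᵢ uᵢ yⁱ
atY : ℕ → Series → Series
atY a u n = ∑[ i < suc n ] (u i * yPow a i n)

atY-cong : ∀ a {u v} → u ≗ v → atY a u ≗ atY a v
atY-cong a eq n = ∑<-cong (suc n) (λ i → cong (_* yPow a i n) (eq i))

atY-extend : ∀ a u {n N} → n ≤ N → atY a u n ≡ ∑[ i < suc N ] (u i * yPow a i n)
atY-extend a u {n} n≤N = ∑<-extend (s≤s n≤N) (λ i → u i * yPow a i n)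
  (λ i n<i → trans (cong (u i *_) (yPow-< a i n n<i)) (*-zeroʳ (u i)))

atY-⊛ : ∀ a u v → atY a u ⊛ atY a v ≗ atY a (u ⊛ v)
atY-⊛ a u v n = trans expand (sym collect)
  where
  N = suc n
  Y = yPow a

  H : ℕ → ℕ → ℕ
  H s t = u s * v t * Y (s + t) n

  expand : (atY a u ⊛ atY a v) n ≡ ∑[ i < N ] ∑[ j < N ] H i j
  expand = begin
    ∑[ p < N ] (atY a u p * atY a v (n ∸ p))
      ≡⟨ ∑<-cong-< N (λ p p<N → cong₂ _*_ (atY-extend a u (≤-pred p<N)) (atY-extend a v (m∸n≤m n p))) ⟩
    ∑[ p < N ] (∑[ i < N ] (u i * Y i p) * ∑[ j < N ] (v j * Y j (n ∸ p)))
      ≡⟨ ∑<-cong N (λ p → ∑<-*-∑< N (λ i → u i * Y i p) (λ j → v j * Y j (n ∸ p))) ⟩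
    ∑[ p < N ] ∑[ i < N ] ∑[ j < N ] (u i * Y i p * (v j * Y j (n ∸ p)))
      ≡⟨ ∑<-cong N (λ p → ∑<-cong N (λ i → ∑<-cong N (λ j → *-interchange (u i) (Y i p) (v j) (Y j (n ∸ p))))) ⟩
    ∑[ p < N ] ∑[ i < N ] ∑[ j < N ] (u i * v j * (Y i p * Y j (n ∸ p)))
      ≡⟨ ∑<-comm N N (λ p i → ∑[ j < N ] (u i * v j * (Y i p * Y j (n ∸ p)))) ⟩
    ∑[ i < N ] ∑[ p < N ] ∑[ j < N ] (u i * v j * (Y i p * Y j (n ∸ p)))
      ≡⟨ ∑<-cong N (λ i → ∑<-comm N N (λ p j → u i * v j * (Y i p * Y j (n ∸ p)))) ⟩
    ∑[ i < N ] ∑[ j < N ] ∑[ p < N ] (u i * v j * (Y i p * Y j (n ∸ p)))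
      ≡⟨ ∑<-cong N (λ i → ∑<-cong N (λ j → ∑<-distribˡ-* N (u i * v j) (λ p → Y i p * Y j (n ∸ p)))) ⟩
    ∑[ i < N ] ∑[ j < N ] (u i * v j * (Y i ⊛ Y j) n)
      ≡⟨ ∑<-cong N (λ i → ∑<-cong N (λ j → cong (u i * v j *_) (yPow-⊛ a i j n))) ⟩
    ∑[ i < N ] ∑[ j < N ] H i j
      ∎

  H-vanish : ∀ s t → n ∸ s < t → H s t ≡ 0
  H-vanish s t n∸s<t = trans (cong (u s * v t *_) (yPow-< a (s + t) n n<s+t)) (*-zeroʳ (u s * v t))
    where
    n<s+t : n < s + t
    n<s+t = ≤-<-trans (m≤n+m∸n n s) (+-monoʳ-< s n∸s<t)

  collect : atY a (u ⊛ v) n ≡ ∑[ i < N ] ∑[ j < N ] H i j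
  collect = begin
    ∑[ l < N ] ((u ⊛ v) l * Y l n)
      ≡⟨ ∑<-cong N (λ l → sym (∑<-distribʳ-* (suc l) (Y l n) (λ s → u s * v (l ∸ s)))) ⟩
    ∑[ l < N ] ∑[ s < suc l ] (u s * v (l ∸ s) * Y l n)
      ≡⟨ ∑<-cong N (λ l → ∑<-cong-< (suc l) (λ s s≤l →
           cong (λ i → u s * v (l ∸ s) * Y i n) (sym (m+[n∸m]≡n (≤-pred s≤l))))) ⟩
    ∑[ l < N ] ∑[ s < suc l ] H s (l ∸ s)
      ≡⟨ ∑<-triangle n H ⟩
    ∑[ s < N ] ∑[ t < suc (n ∸ s) ] H s t
      ≡⟨ ∑<-cong N (λ s → ∑<-extend (s≤s (m∸n≤m n s)) (H s) (λ t → H-vanish s t)) ⟩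
    ∑[ s < N ] ∑[ t < N ] H s t
      ∎

sum-map-applyUpTo : ∀ (g f : ℕ → ℕ) n → sum (map g (applyUpTo f n)) ≡ ∑[ j < n ] g (f j)
sum-map-applyUpTo g f zero    = refl
sum-map-applyUpTo g f (suc n) = cong (g (f 0) +_) (sum-map-applyUpTo g (f ∘ suc) n)

Σ[to]≡∑< : ∀ lo hi g → Σ[ lo to hi ] g ≡ ∑[ j < suc hi ∸ lo ] g (lo + j)
Σ[to]≡∑< lo hi g = sum-map-applyUpTo g (lo +_) (suc hi ∸ lo)

sum-map-concatMap : ∀ {A B : Set} (f : B → ℕ) (h : A → List B) (xs : List A) →
  sum (map f (concatMap h xs)) ≡ sum (map (λ x → sum (map f (h x))) xs)
sum-map-concatMap f h []       = refl
sum-map-concatMap f h (x ∷ xs) = begin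
  sum (map f (h x ++ concatMap h xs))             ≡⟨ cong sum (map-++ f (h x) (concatMap h xs)) ⟩
  sum (map f (h x) ++ map f (concatMap h xs))     ≡⟨ sum-++ (map f (h x)) (map f (concatMap h xs)) ⟩
  sum (map f (h x)) + sum (map f (concatMap h xs))          ≡⟨ cong (sum (map f (h x)) +_) (sum-map-concatMap f h xs) ⟩
  sum (map f (h x)) + sum (map (λ y → sum (map f (h y))) xs) ∎

sum-map-prodVec-∷ : ∀ {k} g i (ys : List (Vec ℕ k)) →
  sum (map (prodVec g) (map (i ∷_) ys)) ≡ g i * sum (map (prodVec g) ys)
sum-map-prodVec-∷ g i []       = sym (*-zeroʳ (g i))
sum-map-prodVec-∷ g i (y ∷ ys) =
  trans (cong (g i * prodVec g y +_) (sum-map-prodVec-∷ g i ys)) (sym (*-distribˡ-+ (g i) _ _))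

compSum-suc : ∀ g n k → compSum g n (suc k) ≡ ∑[ j < n ] (g (suc j) * compSum g (n ∸ suc j) k)
compSum-suc g zero    k = refl
compSum-suc g (suc n) k = begin
  sum (map (prodVec g) (concatMap parts (range 1 (suc n))))        ≡⟨ sum-map-concatMap (prodVec g) parts (range 1 (suc n)) ⟩
  Σ[ 1 to suc n ] (λ i → sum (map (prodVec g) (parts i)))          ≡⟨ Σ[to]≡∑< 1 (suc n) _ ⟩
  ∑[ j < suc n ] sum (map (prodVec g) (parts (suc j)))             ≡⟨ ∑<-cong (suc n) (λ j → sum-map-prodVec-∷ g (suc j) (compositions (suc n ∸ suc j) k)) ⟩
  ∑[ j < suc n ] (g (suc j) * compSum g (suc n ∸ suc j) k)         ∎
  where
  parts : ℕ → List (Vec ℕ (suc k))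
  parts i = map (i ∷_) (compositions (suc n ∸ i) k)

_^⊛_ : Series → ℕ → Series
u ^⊛ zero  = one
u ^⊛ suc k = u ⊛ u ^⊛ k

-- g₀ does not enter compositions into positive parts, hence no condition at 0
compSum≡atY-^⊛ : ∀ a g w → w 0 ≡ 0 → (∀ n → g (suc n) ≡ atY a w (suc n)) →
  ∀ k n → compSum g n k ≡ atY a (w ^⊛ k) n
compSum≡atY-^⊛ a g w w₀≡0 g≡ zero    zero    = refl
compSum≡atY-^⊛ a g w w₀≡0 g≡ zero    (suc n) = sym (∑<-≡0 (suc n) (λ _ _ → refl))
compSum≡atY-^⊛ a g w w₀≡0 g≡ (suc k) n = begin
  compSum g n (suc k)                                                       ≡⟨ compSum-suc g n k ⟩
  ∑[ j < n ] (g (suc j) * compSum g (n ∸ suc j) k)                          ≡⟨ ∑<-cong n (λ j → cong₂ _*_ (g≡ j) (IH (n ∸ suc j))) ⟩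
  ∑[ j < n ] (atY a w (suc j) * atY a (w ^⊛ k) (n ∸ suc j))                 ≡⟨ u₀≡0⇒⊛-tail (atY a w) (atY a (w ^⊛ k)) atY-w-0 n ⟨
  (atY a w ⊛ atY a (w ^⊛ k)) n                                              ≡⟨ atY-⊛ a w (w ^⊛ k) n ⟩
  atY a (w ^⊛ suc k) n                                                      ∎
  where
  IH = compSum≡atY-^⊛ a g w w₀≡0 g≡ k
  atY-w-0 : atY a w 0 ≡ 0
  atY-w-0 = trans (+-identityʳ _) (cong (_* 1) w₀≡0)

-- the coefficients of y / (1 - r y), as a series in y
geom : ℕ → Series
geom r zero    = 0
geom r (suc i) = r ^ i

-- the coefficients of (y / (1 - r y))^k, by the negative binomial theorem
geomPow : ℕ → ℕ → Series
geomPow r zero    i       = one i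
geomPow r (suc k) zero    = 0
geomPow r (suc k) (suc i) = r ^ (i ∸ k) * (i C k)

geom-⊛-suc : ∀ r u i → (geom r ⊛ u) (suc i) ≡ u i + r * (geom r ⊛ u) i
geom-⊛-suc r u i = cong₂ _+_ (*-identityˡ (u i))
  (trans (∑<-cong i (λ p → *-assoc r (r ^ p) (u (i ∸ suc p))))
         (∑<-distribˡ-* i r (λ p → r ^ p * u (i ∸ suc p))))

geomPow-< : ∀ r k i → i < k → geomPow r k i ≡ 0
geomPow-< r (suc k) zero    _         = refl
geomPow-< r (suc k) (suc i) (s≤s i<k) = trans (cong (r ^ (i ∸ k) *_) (k>n⇒nCk≡0 i<k)) (*-zeroʳ (r ^ (i ∸ k)))

geomPow-suc : ∀ r k i → geomPow r (suc k) (suc i) ≡ geomPow r k i + r * geomPow r (suc k) i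
geomPow-suc r zero    zero    = cong suc (sym (*-zeroʳ r))
geomPow-suc r zero    (suc i) = *-assoc r (r ^ i) 1
geomPow-suc r (suc k) zero    = sym (*-zeroʳ r)
geomPow-suc r (suc k) (suc i) = begin
  r ^ (i ∸ k) * (suc i C suc k)                                       ≡⟨ cong (r ^ (i ∸ k) *_) (nCk+nC[k+1]≡[n+1]C[k+1] i k) ⟨
  r ^ (i ∸ k) * (i C k + i C suc k)                                   ≡⟨ *-distribˡ-+ (r ^ (i ∸ k)) (i C k) (i C suc k) ⟩
  r ^ (i ∸ k) * (i C k) + r ^ (i ∸ k) * (i C suc k)                   ≡⟨ cong (r ^ (i ∸ k) * (i C k) +_) lowerExponent ⟩
  r ^ (i ∸ k) * (i C k) + r * (r ^ (i ∸ suc k) * (i C suc k))         ∎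
  where
  lowerExponent : r ^ (i ∸ k) * (i C suc k) ≡ r * (r ^ (i ∸ suc k) * (i C suc k))
  lowerExponent with k <? i
  ... | yes k<i = trans (cong (λ e → r ^ e * (i C suc k)) (+-∸-assoc 1 k<i)) (*-assoc r _ _)
  ... | no  k≮i = begin
    r ^ (i ∸ k) * (i C suc k)               ≡⟨ cong (r ^ (i ∸ k) *_) iC[1+k]≡0 ⟩
    r ^ (i ∸ k) * 0                         ≡⟨ *-zeroʳ (r ^ (i ∸ k)) ⟩
    0                                       ≡⟨ *-zeroʳ r ⟨
    r * 0                                   ≡⟨ cong (r *_) (*-zeroʳ (r ^ (i ∸ suc k))) ⟨
    r * (r ^ (i ∸ suc k) * 0)               ≡⟨ cong (λ c → r * (r ^ (i ∸ suc k) * c)) iC[1+k]≡0 ⟨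
    r * (r ^ (i ∸ suc k) * (i C suc k))     ∎
    where
    iC[1+k]≡0 : i C suc k ≡ 0
    iC[1+k]≡0 = k>n⇒nCk≡0 (s≤s (≮⇒≥ k≮i))

geom-^⊛ : ∀ r k → geom r ^⊛ k ≗ geomPow r k
geom-^⊛ r zero    i       = refl
geom-^⊛ r (suc k) zero    = refl
geom-^⊛ r (suc k) (suc i) = begin
  (geom r ⊛ geom r ^⊛ k) (suc i)                         ≡⟨ geom-⊛-suc r (geom r ^⊛ k) i ⟩
  (geom r ^⊛ k) i + r * (geom r ^⊛ suc k) i              ≡⟨ cong₂ _+_ (geom-^⊛ r k i) (cong (r *_) (geom-^⊛ r (suc k) i)) ⟩
  geomPow r k i + r * geomPow r (suc k) i                ≡⟨ geomPow-suc r k i ⟨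
  geomPow r (suc k) (suc i)                              ∎

-- Σₖ (y / (1 - r y))^k = y / (1 - (r+1) y), truncated at a degree N ≥ i
∑<-geomPow : ∀ r N i → i ≤ N → ∑[ j < N ] geomPow r (suc j) i ≡ geom (suc r) i
∑<-geomPow r N zero    _     = ∑<-≡0 N (λ _ _ → refl)
∑<-geomPow r N (suc i) i<N = begin
  ∑[ j < N ] geomPow r (suc j) (suc i)                                  ≡⟨ ∑<-cong N (λ j → geomPow-suc r j i) ⟩
  ∑[ j < N ] (geomPow r j i + r * geomPow r (suc j) i)                  ≡⟨ ∑<-distrib-+ N (λ j → geomPow r j i) _ ⟩
  ∑[ j < N ] geomPow r j i + ∑[ j < N ] (r * geomPow r (suc j) i)       ≡⟨ cong₂ _+_ dropLast (∑<-distribˡ-* N r (λ j → geomPow r (suc j) i)) ⟩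
  one i + ∑[ j < N ] geomPow r (suc j) i + r * ∑[ j < N ] geomPow r (suc j) i
                                                                        ≡⟨ cong (λ c → one i + c + r * c) (∑<-geomPow r N i (<⇒≤ i<N)) ⟩
  one i + geom (suc r) i + r * geom (suc r) i                           ≡⟨ geom-suc i ⟩
  geom (suc r) (suc i)                                                  ∎
  where
  dropLast : ∑[ j < N ] geomPow r j i ≡ one i + ∑[ j < N ] geomPow r (suc j) i
  dropLast = begin
    ∑[ j < N ] geomPow r j i                       ≡⟨ +-identityʳ _ ⟨
    ∑[ j < N ] geomPow r j i + 0                   ≡⟨ cong (∑[ j < N ] geomPow r j i +_) (geomPow-< r N i i<N) ⟨
    ∑[ j < N ] geomPow r j i + geomPow r N i       ≡⟨ ∑<-suc N (λ j → geomPow r j i) ⟨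
    one i + ∑[ j < N ] geomPow r (suc j) i         ∎
  geom-suc : ∀ i → one i + geom (suc r) i + r * geom (suc r) i ≡ geom (suc r) (suc i)
  geom-suc zero    = cong suc (*-zeroʳ r)
  geom-suc (suc i) = refl

cSeq-binomSeq : ∀ a m n k → cSeq (binomSeq a) (suc m) n k ≡ atY a (geomPow m k) n
fSeq-binomSeq : ∀ a m n → fSeq (binomSeq a) m (suc n) ≡ atY a (geom m) (suc n)

cSeq-binomSeq a m n k =
  trans (compSum≡atY-^⊛ a (fSeq (binomSeq a) m) (geom m) refl (fSeq-binomSeq a m) k n)
        (atY-cong a (geom-^⊛ m k) n)

fSeq-binomSeq a zero    n =
  sym (trans (cong₂ _+_ (trans (*-identityˡ _) (cong (_C n) (+-identityʳ a))) (∑<-≡0 n (λ _ _ → refl)))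
             (+-identityʳ _))
fSeq-binomSeq a (suc m) n = begin
  Σ[ 1 to N ] (cSeq (binomSeq a) (suc m) N)                       ≡⟨ Σ[to]≡∑< 1 N _ ⟩
  ∑[ j < N ] cSeq (binomSeq a) (suc m) N (suc j)                  ≡⟨ ∑<-cong N (λ j → cSeq-binomSeq a m N (suc j)) ⟩
  ∑[ j < N ] ∑[ i < suc N ] (geomPow m (suc j) i * yPow a i N)    ≡⟨ ∑<-comm N (suc N) (λ j i → geomPow m (suc j) i * yPow a i N) ⟩
  ∑[ i < suc N ] ∑[ j < N ] (geomPow m (suc j) i * yPow a i N)    ≡⟨ ∑<-cong-< (suc N) collectGeom ⟩
  atY a (geom (suc m)) N                                          ∎
  where
  N = suc n
  collectGeom : ∀ i → i < suc N → ∑[ j < N ] (geomPow m (suc j) i * yPow a i N) ≡ geom (suc m) i * yPow a i N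
  collectGeom i i≤N = trans (∑<-distribʳ-* N (yPow a i N) (λ j → geomPow m (suc j) i))
                            (cong (_* yPow a i N) (∑<-geomPow m N i (≤-pred i≤N)))

atY-geom : ∀ a r n → atY a (geom r) n ≡ Σ[ 1 to n ] (λ i → r ^ (i ∸ 1) * ((i * a) C (n ∸ i)))
atY-geom a r n = sym (trans (Σ[to]≡∑< 1 n _)
  (∑<-cong-< n (λ j j<n → cong (r ^ j *_) (sym (yPow-≥ a (suc j) n j<n)))))

atY-geomPow : ∀ a r k n → suc k ≤ n →
  atY a (geomPow r (suc k)) n ≡ Σ[ suc k to n ] (λ i → r ^ (i ∸ suc k) * ((i ∸ 1) C k) * ((i * a) C (n ∸ i)))
atY-geomPow a r k n k<n = begin
  ∑[ i < suc n ] (V i * yPow a i n)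
    ≡⟨ cong (λ l → ∑[ i < suc l ] (V i * yPow a i n)) (m+[n∸m]≡n k≤n) ⟨
  ∑[ i < suc k + (n ∸ k) ] (V i * yPow a i n)
    ≡⟨ ∑<-+ (suc k) (n ∸ k) (λ i → V i * yPow a i n) ⟩
  ∑[ i < suc k ] (V i * yPow a i n) + ∑[ j < n ∸ k ] (V (suc k + j) * yPow a (suc k + j) n)
    ≡⟨ cong (_+ ∑[ j < n ∸ k ] (V (suc k + j) * yPow a (suc k + j) n))
            (∑<-≡0 (suc k) (λ i i≤k → cong (_* yPow a i n) (geomPow-< r (suc k) i i≤k))) ⟩
  ∑[ j < n ∸ k ] (V (suc k + j) * yPow a (suc k + j) n)
    ≡⟨ ∑<-cong-< (n ∸ k) (λ j j<n∸k → cong (V (suc k + j) *_) (yPow-≥ a (suc k + j) n (k+j<n j j<n∸k))) ⟩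
  ∑[ j < n ∸ k ] (V (suc k + j) * (((suc k + j) * a) C (n ∸ (suc k + j))))
    ≡⟨ Σ[to]≡∑< (suc k) n _ ⟨
  Σ[ suc k to n ] (λ i → r ^ (i ∸ suc k) * ((i ∸ 1) C k) * ((i * a) C (n ∸ i)))
    ∎
  where
  V = geomPow r (suc k)
  k≤n : k ≤ n
  k≤n = <⇒≤ k<n
  k+j<n : ∀ j → j < n ∸ k → k + j < n
  k+j<n j j<n∸k = subst (k + j <_) (m+[n∸m]≡n k≤n) (+-monoʳ-< k j<n∸k)

-- The identities hold for every a.
mainTheorem4 : (a m : ℕ) → 1 ≤ a → 1 ≤ m → (n k : ℕ) → 1 ≤ k → k ≤ n →
    (cSeq (binomSeq a) m n k
      ≡ Σ[ k to n ] (λ i → (m ∸ 1) ^ (i ∸ k) * ((i ∸ 1) C (k ∸ 1)) * ((i * a) C (n ∸ i))))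
    × (fSeq (binomSeq a) m n
      ≡ Σ[ 1 to n ] (λ i → m ^ (i ∸ 1) * ((i * a) C (n ∸ i))))
mainTheorem4 a (suc m) _ _ (suc n) (suc k) _ k<1+n =
    trans (cSeq-binomSeq a m (suc n) (suc k)) (atY-geomPow a m k (suc n) k<1+n)
  , trans (fSeq-binomSeq a (suc m) n) (atY-geom a (suc m) (suc n))
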